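{- For the $n\times n$ grid $G_n$, $lsimw(G_n)=\Omega(n)$.
   Context: The $n\times n$ grid $G_n$ has vertex set $\{(i,j):1\le i,j\le n\}$ and edges $\{(i,j),(i,j+1)\}$ ($1\le i\le n$, $1\le j\le n-1$) and $\{(i,j),(i+1,j)\}$ ($1\le i\le n-1$, $1\le j\le n$). For a graph $G$ and a linear order $\pi$ of $V(G)$, a matching $M$ crosses $\pi$ if some prefix $\pi_0$ of $\pi$ contains exactly one endpoint of each edge of $M$; $M$ is induced if $G$ has no edge between endpoints of distinct edges of $M$. The linear special induced matching width $lsimw(G)$ is the minimum, over all linear orders $\pi$ of $V(G)$, of the maximum size of an induced matching of $G$ crossing $\pi$. -}

module Defs where

open import Data.Nat using (ℕ; zero; suc; _<_; _≤_; _*_)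
open import Data.Fin using (Fin; toℕ)
open import Data.Product using (_×_; _,_; proj₁; proj₂; Σ; ∃)
open import Data.Sum using (_⊎_)
open import Data.List using (List; length; lookup)
open import Relation.Nullary using (¬_)
open import Relation.Binary.PropositionalEquality using (_≡_)
open import Function.Definitions using (Injective)

record Graph : Set₁ where
  field
    V   : Set
    Adj : V → V → Set
open Graph public

GridAdj : (n : ℕ) → Fin n × Fin n → Fin n × Fin n → Set
GridAdj n (i , j) (i' , j') =
  (i ≡ i' × toℕ j' ≡ suc (toℕ j)) ⊎
  (i ≡ i' × toℕ j ≡ suc (toℕ j')) ⊎
  (j ≡ j' × toℕ i' ≡ suc (toℕ i)) ⊎
  (j ≡ j' × toℕ i ≡ suc (toℕ i'))

Grid : ℕ → Graph
Grid n = record { V = Fin n × Fin n ; Adj = GridAdj n }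

-- A linear order of V(G) is given by an injective rank function V → ℕ
-- (u before v iff rank u < rank v).  Prefixes of the order are exactly
-- the sets { v : rank v < t } for t : ℕ.
record LinearOrder (G : Graph) : Set where
  field
    rank  : V G → ℕ
    rank-injective : Injective _≡_ _≡_ rank
open LinearOrder public

Edge : Graph → Set
Edge G = Σ (V G × V G) λ p → Adj G (proj₁ p) (proj₂ p)

endpt₁ endpt₂ : {G : Graph} → Edge G → V G
endpt₁ e = proj₁ (proj₁ e)
endpt₂ e = proj₂ (proj₁ e)

IsEndpoint : {G : Graph} → V G → Edge G → Set
IsEndpoint x e = x ≡ endpt₁ e ⊎ x ≡ endpt₂ e

IsInducedMatching : (G : Graph) → List (Edge G) → Set
IsInducedMatching G M =
  (a b : Fin (length M)) → ¬ (a ≡ b) →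
    (∀ x y → IsEndpoint {G} x (lookup M a) → IsEndpoint {G} y (lookup M b) →
       ¬ (x ≡ y) × ¬ Adj G x y)

Crosses : (G : Graph) → LinearOrder G → List (Edge G) → Set
Crosses G π M = ∃ λ t → (a : Fin (length M)) →
  (rank π (endpt₁ (lookup M a)) < t × ¬ (rank π (endpt₂ (lookup M a)) < t)) ⊎
  (rank π (endpt₂ (lookup M a)) < t × ¬ (rank π (endpt₁ (lookup M a)) < t))

-- lsimw(G) ≥ k  (unfolding min over π of max over crossing induced matchings):
-- every linear order is crossed by an induced matching with at least k edges.
LsimwAtLeast : Graph → ℕ → Set
LsimwAtLeast G k = (π : LinearOrder G) →
  ∃ λ (M : List (Edge G)) → IsInducedMatching G M × Crosses G π M × k ≤ length M

-- Take the shortest prefix of π containing a whole row or column; transposing the order if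
-- needed, it is row i₀, completed at its vertex in column j*. Every column j ≠ j* meets this
-- prefix (at (i₀, j)) but is not contained in it, so it contains a vertical edge crossing the
-- prefix. Vertical edges in columns at distance ≥ 2 form an induced matching, and the columns
-- of parity opposite to j* provide ⌊n/2⌋ ≥ n/3 of them.
module Submission where

open import Defs
open import Data.Nat using (ℕ; suc; _≤_; _*_)
open import Data.Product using (∃; ∃₂; _×_)

open import Data.Nat using (zero; _+_; _∸_; _<_; _<?_; ⌊_/2⌋; z≤n; s≤s; s≤s⁻¹)
open import Data.Nat.Properties
open import Data.Nat.DivMod using (_%_; m%n<n; [m+kn]%n≡m%n; m<n⇒m%n≡m)
open import Data.Fin as Fin using (Fin; toℕ; inject₁; fromℕ<; cast)
open import Data.Fin.Properties using (toℕ<n; toℕ-fromℕ<; toℕ-injective; toℕ-inject₁; cast-involutive)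
open import Data.Product using (_,_; proj₁; proj₂; swap)
open import Data.Sum using (_⊎_; inj₁; inj₂)
import Data.Sum as Sum
open import Data.List using (List; length; lookup; tabulate; allFin)
open import Data.List.Properties using (length-tabulate; lookup-tabulate)
open import Data.List.Extrema.Nat using (argmax; argmin; f[xs]≤f[argmax]; f[argmin]≤f[xs])
open import Data.List.Membership.Propositional.Properties using (∈-allFin)
import Data.List.Relation.Unary.All as All
open import Relation.Nullary using (¬_; yes; no; contradiction)
open import Relation.Unary using (Decidable)
open import Relation.Binary.Definitions using (tri<; tri≈; tri>)
open import Relation.Binary.PropositionalEquality
open import Function using (_∘_)

ChangesAt : ∀ {m} → (Fin (suc m) → Set) → Fin m → Set
ChangesAt P x = (P (inject₁ x) × ¬ P (Fin.suc x)) ⊎ (P (Fin.suc x) × ¬ P (inject₁ x))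

changesAt-suc : ∀ {m} (P : Fin (suc (suc m)) → Set) → ∃ (ChangesAt (P ∘ Fin.suc)) → ∃ (ChangesAt P)
changesAt-suc P (x , c) = Fin.suc x , c

∃-changesAt : ∀ {m} (P : Fin (suc m) → Set) → Decidable P →
  (a b : Fin (suc m)) → P a → ¬ P b → ∃ (ChangesAt P)
∃-changesAt {zero} P P? Fin.zero Fin.zero pa ¬pb = contradiction pa ¬pb
∃-changesAt {suc m} P P? a b pa ¬pb with P? Fin.zero | P? (Fin.suc Fin.zero)
... | yes p₀ | no ¬p₁ = Fin.zero , inj₁ (p₀ , ¬p₁)
... | no ¬p₀ | yes p₁ = Fin.zero , inj₂ (p₁ , ¬p₀)
-- If P agrees at 0 and 1, an endpoint at 0 can be moved to 1 and the search continues on the tail.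
∃-changesAt {suc m} P P? a Fin.zero pa ¬pb | yes p₀ | yes _ = contradiction p₀ ¬pb
∃-changesAt {suc m} P P? Fin.zero (Fin.suc b) pa ¬pb | yes _ | yes p₁ =
  changesAt-suc P (∃-changesAt (P ∘ Fin.suc) (P? ∘ Fin.suc) Fin.zero b p₁ ¬pb)
∃-changesAt {suc m} P P? (Fin.suc a) (Fin.suc b) pa ¬pb | yes _ | yes _ =
  changesAt-suc P (∃-changesAt (P ∘ Fin.suc) (P? ∘ Fin.suc) a b pa ¬pb)
∃-changesAt {suc m} P P? Fin.zero b pa ¬pb | no ¬p₀ | no _ = contradiction pa ¬p₀
∃-changesAt {suc m} P P? (Fin.suc a) Fin.zero pa ¬pb | no _ | no ¬p₁ =
  changesAt-suc P (∃-changesAt (P ∘ Fin.suc) (P? ∘ Fin.suc) a Fin.zero pa ¬p₁)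
∃-changesAt {suc m} P P? (Fin.suc a) (Fin.suc b) pa ¬pb | no _ | no _ =
  changesAt-suc P (∃-changesAt (P ∘ Fin.suc) (P? ∘ Fin.suc) a b pa ¬pb)

CrossesAt : (G : Graph) → LinearOrder G → ℕ → Edge G → Set
CrossesAt G π t e =
  (rank π (endpt₁ {G} e) < t × ¬ rank π (endpt₂ {G} e) < t) ⊎
  (rank π (endpt₂ {G} e) < t × ¬ rank π (endpt₁ {G} e) < t)

Separated : (G : Graph) → Edge G → Edge G → Set
Separated G e e′ = ∀ x y → IsEndpoint {G} x e → IsEndpoint {G} y e′ → ¬ x ≡ y × ¬ Adj G x y

CrossedBy : (G : Graph) → LinearOrder G → ℕ → Set
CrossedBy G π k =
  ∃ λ (M : List (Edge G)) → IsInducedMatching G M × Crosses G π M × k ≤ length M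

crossedBy-mono : ∀ {G π k k′} → k ≤ k′ → CrossedBy G π k′ → CrossedBy G π k
crossedBy-mono k≤k′ (M , induced , crosses , k′≤) = M , induced , crosses , ≤-trans k≤k′ k′≤

crossedBy-tabulate : ∀ {G} π {k} t (E : Fin k → Edge G) →
  (∀ y → CrossesAt G π t (E y)) →
  (∀ {y y′} → ¬ y ≡ y′ → Separated G (E y) (E y′)) →
  CrossedBy G π k
crossedBy-tabulate {G} π t E crossing separated =
  tabulate E , induced , (t , crosses) , ≤-reflexive (sym (length-tabulate E))
  where
  index = cast (length-tabulate E)

  index⁻¹ = cast (sym (length-tabulate E))

  index⁻¹∘index : ∀ a → index⁻¹ (index a) ≡ a
  index⁻¹∘index = cast-involutive (sym (length-tabulate E)) (length-tabulate E)

  lookup≡ : ∀ a → lookup (tabulate E) a ≡ E (index a)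
  lookup≡ a = begin
    lookup (tabulate E) a                   ≡⟨ cong (lookup (tabulate E)) (index⁻¹∘index a) ⟨
    lookup (tabulate E) (index⁻¹ (index a)) ≡⟨ lookup-tabulate E (index a) ⟩
    E (index a)                             ∎
    where open ≡-Reasoning

  crosses : ∀ a → CrossesAt G π t (lookup (tabulate E) a)
  crosses a = subst (CrossesAt G π t) (sym (lookup≡ a)) (crossing (index a))

  index-injective : ∀ {a b} → index a ≡ index b → a ≡ b
  index-injective {a} {b} eq =
    trans (sym (index⁻¹∘index a)) (trans (cong index⁻¹ eq) (index⁻¹∘index b))

  induced : IsInducedMatching G (tabulate E)
  induced a b a≢b = subst₂ (Separated G) (sym (lookup≡ a)) (sym (lookup≡ b))
    (separated (a≢b ∘ index-injective))

module _ {G : Graph} (φ : V G → V G) (φ-involutive : ∀ v → φ (φ v) ≡ v)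
         (φ-adj : ∀ {u v} → Adj G u v → Adj G (φ u) (φ v)) where

  relabel : LinearOrder G → LinearOrder G
  relabel π = record
    { rank           = rank π ∘ φ
    ; rank-injective = λ {u} {v} eq →
        trans (sym (φ-involutive u)) (trans (cong φ (rank-injective π eq)) (φ-involutive v))
    }

  mapEdge : Edge G → Edge G
  mapEdge ((u , v) , u~v) = (φ u , φ v) , φ-adj u~v

  isEndpoint-mapEdge : ∀ {x} e → IsEndpoint {G} x (mapEdge e) → IsEndpoint {G} (φ x) e
  isEndpoint-mapEdge e (inj₁ refl) = inj₁ (φ-involutive _)
  isEndpoint-mapEdge e (inj₂ refl) = inj₂ (φ-involutive _)

  separated-mapEdge : ∀ e e′ → Separated G e e′ → Separated G (mapEdge e) (mapEdge e′)
  separated-mapEdge e e′ sep x y x∈e y∈e′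
    with sep (φ x) (φ y) (isEndpoint-mapEdge e x∈e) (isEndpoint-mapEdge e′ y∈e′)
  ... | φx≢φy , ¬φx~φy = φx≢φy ∘ cong φ , ¬φx~φy ∘ φ-adj

  crossedBy-relabel : ∀ π {k} → CrossedBy G (relabel π) k → CrossedBy G π k
  crossedBy-relabel π (M , induced , (t , crosses) , k≤) =
    crossedBy-mono {π = π} k≤ (crossedBy-tabulate π t (mapEdge ∘ lookup M) crosses
      (λ {a} {b} a≢b → separated-mapEdge (lookup M a) (lookup M b) (induced a b a≢b)))

transpose-adj : ∀ {n} {u v : Fin n × Fin n} → GridAdj n u v → GridAdj n (swap u) (swap v)
transpose-adj (inj₁ p)               = inj₂ (inj₂ (inj₁ p))
transpose-adj (inj₂ (inj₁ p))        = inj₂ (inj₂ (inj₂ p))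
transpose-adj (inj₂ (inj₂ (inj₁ p))) = inj₁ p
transpose-adj (inj₂ (inj₂ (inj₂ p))) = inj₂ (inj₁ p)

transpose : ∀ {n} → LinearOrder (Grid n) → LinearOrder (Grid n)
transpose = relabel swap (λ _ → refl) transpose-adj

crossedBy-transpose : ∀ {n} (π : LinearOrder (Grid n)) {k} →
  CrossedBy (Grid n) (transpose π) k → CrossedBy (Grid n) π k
crossedBy-transpose = crossedBy-relabel swap (λ _ → refl) transpose-adj

verticalEdge : ∀ {m} → Fin m → Fin (suc m) → Edge (Grid (suc m))
verticalEdge x j =
  ((inject₁ x , j) , (Fin.suc x , j)) , inj₂ (inj₂ (inj₁ (refl , cong suc (sym (toℕ-inject₁ x)))))

verticalEdge-column : ∀ {m v} (x : Fin m) j →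
  IsEndpoint {Grid (suc m)} v (verticalEdge x j) → proj₂ v ≡ j
verticalEdge-column x j (inj₁ refl) = refl
verticalEdge-column x j (inj₂ refl) = refl

Apart : ℕ → ℕ → Set
Apart a b = suc a < b ⊎ suc b < a

apart-irrefl : ∀ a → ¬ Apart a a
apart-irrefl a (inj₁ 1+a<a) = <-irrefl refl (<-trans (n<1+n a) 1+a<a)
apart-irrefl a (inj₂ 1+a<a) = <-irrefl refl (<-trans (n<1+n a) 1+a<a)

apart-suc : ∀ a → ¬ Apart a (suc a)
apart-suc a (inj₁ 1+a<1+a) = <-irrefl refl 1+a<1+a
apart-suc a (inj₂ 2+a<a)   = <-irrefl refl (<-trans (n<1+n a) (<-trans (n<1+n (suc a)) 2+a<a))

gridAdj⇒¬apart : ∀ {n i j i′ j′} → GridAdj n (i , j) (i′ , j′) → ¬ Apart (toℕ j) (toℕ j′)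
gridAdj⇒¬apart {j = j} (inj₁ (_ , j′≡1+j)) rewrite j′≡1+j = apart-suc (toℕ j)
gridAdj⇒¬apart {j′ = j′} (inj₂ (inj₁ (_ , j≡1+j′))) rewrite j≡1+j′ = apart-suc (toℕ j′) ∘ Sum.swap
gridAdj⇒¬apart {j = j} (inj₂ (inj₂ (inj₁ (refl , _)))) = apart-irrefl (toℕ j)
gridAdj⇒¬apart {j = j} (inj₂ (inj₂ (inj₂ (refl , _)))) = apart-irrefl (toℕ j)

apartColumns⇒separated : ∀ {n} {u v : Fin n × Fin n} → Apart (toℕ (proj₂ u)) (toℕ (proj₂ v)) →
  ¬ u ≡ v × ¬ GridAdj n u v
apartColumns⇒separated {u = _ , j} j⋈j′ =
  (λ { refl → apart-irrefl (toℕ j) j⋈j′ }) , λ u~v → gridAdj⇒¬apart u~v j⋈j′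

verticalEdges-separated : ∀ {m} (x x′ : Fin m) {j j′} → Apart (toℕ j) (toℕ j′) →
  Separated (Grid (suc m)) (verticalEdge x j) (verticalEdge x′ j′)
verticalEdges-separated x x′ {j} {j′} j⋈j′ u v u∈e v∈e′ =
  apartColumns⇒separated (subst₂ (λ c c′ → Apart (toℕ c) (toℕ c′))
    (sym (verticalEdge-column x j u∈e)) (sym (verticalEdge-column x′ j′ v∈e′)) j⋈j′)

oppositeParity : ∀ a → ∃ λ p → p ≤ 1 × (∀ y → ¬ y * 2 + p ≡ a)
oppositeParity a = p , m∸n≤m 1 (a % 2) , avoids
  where
  p = 1 ∸ a % 2

  ¬r≡1∸r : ∀ r → r < 2 → ¬ r ≡ 1 ∸ r
  ¬r≡1∸r 0 _ ()
  ¬r≡1∸r 1 _ ()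
  ¬r≡1∸r (suc (suc r)) (s≤s (s≤s ()))

  avoids : ∀ y → ¬ y * 2 + p ≡ a
  avoids y eq = ¬r≡1∸r (a % 2) (m%n<n a 2) (begin
    a % 2           ≡⟨ cong (_% 2) eq ⟨
    (y * 2 + p) % 2 ≡⟨ cong (_% 2) (+-comm (y * 2) p) ⟩
    (p + y * 2) % 2 ≡⟨ [m+kn]%n≡m%n p y 2 ⟩
    p % 2           ≡⟨ m<n⇒m%n≡m (s≤s (m∸n≤m 1 (a % 2))) ⟩
    p               ∎)
    where open ≡-Reasoning

⌊n/2⌋*2≤n : ∀ n → ⌊ n /2⌋ * 2 ≤ n
⌊n/2⌋*2≤n 0             = z≤n
⌊n/2⌋*2≤n 1             = z≤n
⌊n/2⌋*2≤n (suc (suc n)) = s≤s (s≤s (⌊n/2⌋*2≤n n))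

n≤3*⌊n/2⌋ : ∀ n → 2 ≤ n → n ≤ 3 * ⌊ n /2⌋
n≤3*⌊n/2⌋ 1 (s≤s ())
n≤3*⌊n/2⌋ 2 _ = s≤s (s≤s z≤n)
n≤3*⌊n/2⌋ 3 _ = ≤-refl
n≤3*⌊n/2⌋ (suc (suc n@(suc (suc _)))) _ = begin
  2 + n               ≤⟨ +-monoʳ-≤ 2 (n≤3*⌊n/2⌋ n (s≤s (s≤s z≤n))) ⟩
  2 + 3 * ⌊ n /2⌋     ≤⟨ n≤1+n _ ⟩
  3 + 3 * ⌊ n /2⌋     ≡⟨ *-suc 3 ⌊ n /2⌋ ⟨
  3 * suc ⌊ n /2⌋     ∎
  where open ≤-Reasoning

spacedColumn< : ∀ p {y y′} → y < y′ → suc (y * 2 + p) < y′ * 2 + p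
spacedColumn< p y<y′ = +-monoˡ-< p (*-monoˡ-≤ 2 y<y′)

spacedColumns-apart : ∀ p {y y′} → ¬ y ≡ y′ → Apart (y * 2 + p) (y′ * 2 + p)
spacedColumns-apart p {y} {y′} y≢y′ with <-cmp y y′
... | tri< y<y′ _ _ = inj₁ (spacedColumn< p y<y′)
... | tri≈ _ y≡y′ _ = contradiction y≡y′ y≢y′
... | tri> _ _ y′<y = inj₂ (spacedColumn< p y′<y)

spacedColumn<n : ∀ n {p y} → p ≤ 1 → y < ⌊ n /2⌋ → y * 2 + p < n
spacedColumn<n n {p} {y} p≤1 y<⌊n/2⌋ = begin-strict
  y * 2 + p    ≤⟨ +-monoʳ-≤ (y * 2) p≤1 ⟩
  y * 2 + 1    ≡⟨ +-comm (y * 2) 1 ⟩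
  suc (y * 2)  <⟨ n<1+n _ ⟩
  suc y * 2    ≤⟨ *-monoˡ-≤ 2 y<⌊n/2⌋ ⟩
  ⌊ n /2⌋ * 2  ≤⟨ ⌊n/2⌋*2≤n n ⟩
  n            ∎
  where open ≤-Reasoning

verticalCrossing : ∀ {m} (π : LinearOrder (Grid (suc m))) t j i i′ →
  rank π (i , j) < t → ¬ rank π (i′ , j) < t →
  ∃ λ x → CrossesAt (Grid (suc m)) π t (verticalEdge x j)
verticalCrossing π t j =
  ∃-changesAt (λ i → rank π (i , j) < t) (λ i → rank π (i , j) <? t)

-- Opaque, since unfolding argmax over allFin (suc m) makes conversion checking blow up.
opaque
  argmaxFin argminFin : ∀ {m} → (Fin (suc m) → ℕ) → Fin (suc m)
  argmaxFin {m} f = argmax f Fin.zero (allFin (suc m))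
  argminFin {m} f = argmin f Fin.zero (allFin (suc m))

  f≤f[argmaxFin] : ∀ {m} (f : Fin (suc m) → ℕ) j → f j ≤ f (argmaxFin f)
  f≤f[argmaxFin] {m} f j = All.lookup (f[xs]≤f[argmax] {f = f} Fin.zero (allFin (suc m))) (∈-allFin j)

  f[argminFin]≤f : ∀ {m} (f : Fin (suc m) → ℕ) i → f (argminFin f) ≤ f i
  f[argminFin]≤f {m} f i = All.lookup (f[argmin]≤f[xs] {f = f} Fin.zero (allFin (suc m))) (∈-allFin i)

module _ {m} (π : LinearOrder (Grid (suc m))) where

  rowTop : Fin (suc m) → Fin (suc m)
  rowTop i = argmaxFin (λ j → rank π (i , j))

  rowMax : Fin (suc m) → ℕ
  rowMax i = rank π (i , rowTop i)

  rank≤rowMax : ∀ i j → rank π (i , j) ≤ rowMax i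
  rank≤rowMax i = f≤f[argmaxFin] (λ j → rank π (i , j))

  firstRow : Fin (suc m)
  firstRow = argminFin rowMax

  rowMax[firstRow]≤ : ∀ i → rowMax firstRow ≤ rowMax i
  rowMax[firstRow]≤ = f[argminFin]≤f rowMax

crossedBy-rowCompletedFirst : ∀ {m} (π : LinearOrder (Grid (suc m))) i₀ →
  (∀ j → rowMax π i₀ ≤ rowMax (transpose π) j) → CrossedBy (Grid (suc m)) π ⌊ suc m /2⌋
crossedBy-rowCompletedFirst {m} π i₀ first =
  crossedBy-tabulate π t (λ y → verticalEdge (proj₁ (crossing y)) (column y)) (proj₂ ∘ crossing)
    (λ {y} {y′} y≢y′ → verticalEdges-separated _ _
      (subst₂ Apart (sym (toℕ-column y)) (sym (toℕ-column y′))
        (spacedColumns-apart p (y≢y′ ∘ toℕ-injective))))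
  where
  j* = rowTop π i₀
  t  = suc (rowMax π i₀)

  columnLeaves : ∀ j → ¬ j ≡ j* → ¬ rank π (rowTop (transpose π) j , j) < t
  columnLeaves j j≢j* r<t =
    j≢j* (cong proj₂ (rank-injective π (≤-antisym (s≤s⁻¹ r<t) (first j))))

  p      = proj₁ (oppositeParity (toℕ j*))
  p≤1    = proj₁ (proj₂ (oppositeParity (toℕ j*)))
  avoids = proj₂ (proj₂ (oppositeParity (toℕ j*)))

  column : Fin ⌊ suc m /2⌋ → Fin (suc m)
  column y = fromℕ< (spacedColumn<n (suc m) p≤1 (toℕ<n y))

  toℕ-column : ∀ y → toℕ (column y) ≡ toℕ y * 2 + p
  toℕ-column y = toℕ-fromℕ< _

  column≢j* : ∀ y → ¬ column y ≡ j*
  column≢j* y eq = avoids (toℕ y) (trans (sym (toℕ-column y)) (cong toℕ eq))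

  crossing : ∀ y → ∃ λ x → CrossesAt (Grid (suc m)) π t (verticalEdge x (column y))
  crossing y = verticalCrossing π t (column y) i₀ (rowTop (transpose π) (column y))
    (s≤s (rank≤rowMax π i₀ (column y))) (columnLeaves (column y) (column≢j* y))

lsimw-grid : ∀ m → LsimwAtLeast (Grid (suc m)) ⌊ suc m /2⌋
lsimw-grid m π with ≤-total (rowMax π (firstRow π)) (rowMax (transpose π) (firstRow (transpose π)))
... | inj₁ row-first = crossedBy-rowCompletedFirst π (firstRow π)
        (λ j → ≤-trans row-first (rowMax[firstRow]≤ (transpose π) j))
... | inj₂ column-first = crossedBy-transpose π
        (crossedBy-rowCompletedFirst (transpose π) (firstRow (transpose π))
          (λ i → ≤-trans column-first (rowMax[firstRow]≤ π i)))

proposition3 : ∃₂ λ (c N : ℕ) → (n : ℕ) → N ≤ n →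
    ∃ λ (k : ℕ) → n ≤ suc c * k × LsimwAtLeast (Grid n) k
proposition3 = 2 , 2 , λ where
  zero    ()
  (suc m) 2≤n → ⌊ suc m /2⌋ , n≤3*⌊n/2⌋ (suc m) 2≤n , lsimw-grid m
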